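{- Let $l_n$ denote the number of restricted growth functions $f=f_1\cdots f_n$ over $[n]$ such that $u_i=0$ for all $i\in[n]$, where $u_i$ is the number of positions $j<i$ with $j\in\operatorname{LrMax}(f)$, $f_j$ occurring exactly once in $f$, and $f_j<f_i$; set $l_0=l_1=1$. Then for all $n\ge2$, $$l_n=\sum_{k=1}^{n-1}\binom{n-1}{k}\,l_{n-k-1}.$$
   Context: A restricted growth function over $[n]$ is a word $f=f_1\cdots f_n$ with $f_1=1$ and $f_i\le 1+\max\{f_1,\dots,f_{i-1}\}$ for $2\le i\le n$. $\operatorname{LrMax}(f)=\{i: f_i>f_j \text{ for all } j<i\}$. -}

module Defs where

open import Data.Nat using (ℕ; zero; suc; _≤_; _<_; _⊔_; _≟_; _<?_; _≤?_)
open import Data.List using (List; []; _∷_; length; filter; applyUpTo; concatMap; map; foldr)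
open import Data.List.Relation.Unary.All using (All; all?)
open import Data.Product using (_×_)
open import Relation.Nullary using (Dec; yes; no)
open import Relation.Nullary.Decidable using (_×-dec_)
open import Relation.Binary.PropositionalEquality using (_≡_)

-- Words are lists f = f₁ ⋯ fₙ; positions are 1-based.
-- at f i = fᵢ for 1 ≤ i ≤ length f (default 0 elsewhere, never used).
at : List ℕ → ℕ → ℕ
at []       _             = 0
at (x ∷ xs) zero          = 0
at (x ∷ xs) (suc zero)    = x
at (x ∷ xs) (suc (suc i)) = at xs (suc i)

[_] : ℕ → List ℕ
[ m ] = applyUpTo suc m

before : ℕ → List ℕ
before zero    = []
before (suc i) = [ i ]

maxBefore : List ℕ → ℕ → ℕ
maxBefore f i = foldr (λ j m → at f j ⊔ m) 0 (before i)

IsRGF : List ℕ → Set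
IsRGF []      = _≡_ 0 0
IsRGF f@(_ ∷ _) =
  (at f 1 ≡ 1) × All (λ i → (1 ≤ at f i) × (at f i ≤ suc (maxBefore f i))) [ length f ]

InLrMax : List ℕ → ℕ → Set
InLrMax f i = All (λ j → at f j < at f i) (before i)

occ : List ℕ → ℕ → ℕ
occ f a = length (filter (λ k → at f k ≟ a) [ length f ])

inLrMax? : (f : List ℕ) (i : ℕ) → Dec (InLrMax f i)
inLrMax? f i = all? (λ j → at f j <? at f i) (before i)

Counted : List ℕ → ℕ → ℕ → Set
Counted f i j = InLrMax f j × (occ f (at f j) ≡ 1) × (at f j < at f i)

counted? : (f : List ℕ) (i j : ℕ) → Dec (Counted f i j)
counted? f i j = inLrMax? f j ×-dec (occ f (at f j) ≟ 1) ×-dec (at f j <? at f i)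

u : List ℕ → ℕ → ℕ
u f i = length (filter (counted? f i) (before i))

isRGF? : (f : List ℕ) → Dec (IsRGF f)
isRGF? [] = yes _≡_.refl
isRGF? f@(_ ∷ _) =
  (at f 1 ≟ 1) ×-dec all? (λ i → (1 ≤? at f i) ×-dec (at f i ≤? suc (maxBefore f i))) [ length f ]

Good : List ℕ → Set
Good f = IsRGF f × All (λ i → u f i ≡ 0) [ length f ]

good? : (f : List ℕ) → Dec (Good f)
good? f = isRGF? f ×-dec all? (λ i → u f i ≟ 0) [ length f ]

words : ℕ → ℕ → List (List ℕ)
words zero    k = [] ∷ []
words (suc m) k = concatMap (λ w → map (λ a → a ∷ w) [ k ]) (words m k)

-- lₙ : number of RGFs over [n] with uᵢ = 0 for all i (every RGF over [n]
-- has letters in {1,…,n}, so enumerating words over {1,…,n} is exhaustive);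
-- l₀ = 1 by convention.
l : ℕ → ℕ
l zero    = 1
l (suc n) = length (filter good? (words (suc n) (suc n)))

{-# OPTIONS --safe #-}
-- In a restricted growth function every value up to the maximum of a prefix occurs in that
-- prefix, so a value v occurring only once exceeds every letter before it: it is a
-- left-to-right maximum, and uᵢ > 0 at any later position i with fᵢ > v. Hence all uᵢ vanish
-- iff every value below max f occurs at least twice. Such a word of length n ≥ 2 starts with 1;
-- deleting its 1s and lowering the other letters by one gives a bijection onto pairs of a set of
-- k ≥ 1 further positions of 1 among the last n − 1 and a word of the same kind of length
-- n − 1 − k. As lₙ enumerates all words over {1,…,n}, the count is carried out with sums over
-- these enumerations, using that enlarging the alphabet adds no such words.
module Submission where

open import Defs
open import Data.Nat using (ℕ; zero; suc; _+_; _*_; _∸_; _≤_; _<_; _≤′_; ≤′-refl; ≤′-step; _⊔_; _≟_; _≤?_; _<?_; z≤n; s≤s; s≤s⁻¹; z<s)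
open import Data.Nat.Properties
open import Algebra.Properties.CommutativeSemigroup +-commutativeSemigroup using (interchange)
open import Data.Nat.Combinatorics using (_C_; nCk+nC[k+1]≡[n+1]C[k+1]; k>n⇒nCk≡0)
open import Data.Nat.ListAction using (sum)
open import Data.Nat.ListAction.Properties using (sum-++)
open import Data.List using (List; []; _∷_; _++_; _∷ʳ_; map; length; filter; applyUpTo; upTo; concatMap; foldr)
open import Data.List.Properties using (filter-none; filter-some; map-cong; map-∘; map-++; map-applyUpTo; map-upTo; foldr-map; applyUpTo-∷ʳ; length-++)
open import Data.List.Relation.Unary.All using (All; []; _∷_)
open import Data.List.Relation.Unary.All.Properties using (applyUpTo⁺₁; applyUpTo⁻)
open import Data.List.Relation.Unary.Any using (Any; here; there)
open import Data.List.Relation.Unary.Any.Properties using (applyUpTo⁺)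
open import Data.List.Membership.Propositional using (_∈_)
open import Data.List.Membership.Propositional.Properties using (∈-∃++)
open import Data.Bool using (true; false)
open import Data.Unit using (⊤)
open import Data.Product using (∃; _×_; _,_; proj₁; proj₂)
open import Data.Sum using (inj₁; inj₂)
open import Function using (_∘_; _⇔_; mk⇔; Equivalence)
open import Relation.Nullary using (Dec; yes; no; ¬_; _because_; contradiction)
open import Relation.Nullary.Decidable using (_×-dec_)
open import Relation.Binary.PropositionalEquality hiding ([_])
open ≡-Reasoning

𝟙 : {P : Set} → Dec P → ℕ
𝟙 (true because _) = 1
𝟙 (false because _) = 0

module _ {P : Set} where

  𝟙-true : (P? : Dec P) → P → 𝟙 P? ≡ 1
  𝟙-true (yes _) _  = refl
  𝟙-true (no ¬p) p = contradiction p ¬p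

  𝟙-false : (P? : Dec P) → ¬ P → 𝟙 P? ≡ 0
  𝟙-false (yes p) ¬p = contradiction p ¬p
  𝟙-false (no _)  _  = refl

  𝟙-cong : {Q : Set} (P? : Dec P) (Q? : Dec Q) → P ⇔ Q → 𝟙 P? ≡ 𝟙 Q?
  𝟙-cong P? (yes q) P⇔Q = 𝟙-true P? (Equivalence.from P⇔Q q)
  𝟙-cong P? (no ¬q) P⇔Q = 𝟙-false P? (¬q ∘ Equivalence.to P⇔Q)

  𝟙-×-dec : {Q : Set} (P? : Dec P) (Q? : Dec Q) → 𝟙 (P? ×-dec Q?) ≡ 𝟙 P? * 𝟙 Q?
  𝟙-×-dec (yes p) (yes q) = refl
  𝟙-×-dec (yes p) (no ¬q) = refl
  𝟙-×-dec (no ¬p) Q?      = refl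

𝟙-≟-suc : ∀ a b → 𝟙 (suc a ≟ suc b) ≡ 𝟙 (a ≟ b)
𝟙-≟-suc a b = 𝟙-cong (suc a ≟ suc b) (a ≟ b) (mk⇔ suc-injective (cong suc))

∑ : {A : Set} → List A → (A → ℕ) → ℕ
∑ xs F = sum (map F xs)

infix 5 ∑
syntax ∑ xs (λ x → e) = ∑[ x ∈ xs ] e

module _ {A : Set} where

  length-filter≡∑𝟙 : {P : A → Set} (P? : ∀ x → Dec (P x)) (xs : List A) →
    length (filter P? xs) ≡ ∑[ x ∈ xs ] 𝟙 (P? x)
  length-filter≡∑𝟙 P? []       = refl
  length-filter≡∑𝟙 P? (x ∷ xs) with P? x
  ... | yes _ = cong suc (length-filter≡∑𝟙 P? xs)
  ... | no _  = length-filter≡∑𝟙 P? xs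

  ∑-cong : {F G : A → ℕ} → (∀ x → F x ≡ G x) → (xs : List A) → ∑ xs F ≡ ∑ xs G
  ∑-cong F≗G xs = cong sum (map-cong F≗G xs)

  ∑-zero : (xs : List A) → ∑[ x ∈ xs ] 0 ≡ 0
  ∑-zero []       = refl
  ∑-zero (x ∷ xs) = ∑-zero xs

  ∑-distrib-+ : (F G : A → ℕ) (xs : List A) → ∑[ x ∈ xs ] (F x + G x) ≡ ∑ xs F + ∑ xs G
  ∑-distrib-+ F G []       = refl
  ∑-distrib-+ F G (x ∷ xs) =
    trans (cong (F x + G x +_) (∑-distrib-+ F G xs)) (interchange (F x) (G x) (∑ xs F) (∑ xs G))

  *-distribˡ-∑ : (c : ℕ) (F : A → ℕ) (xs : List A) → c * ∑ xs F ≡ ∑[ x ∈ xs ] c * F x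
  *-distribˡ-∑ c F []       = *-zeroʳ c
  *-distribˡ-∑ c F (x ∷ xs) = trans (*-distribˡ-+ c (F x) (∑ xs F)) (cong (c * F x +_) (*-distribˡ-∑ c F xs))

  *-distribʳ-∑ : (c : ℕ) (F : A → ℕ) (xs : List A) → ∑ xs F * c ≡ ∑[ x ∈ xs ] F x * c
  *-distribʳ-∑ c F []       = refl
  *-distribʳ-∑ c F (x ∷ xs) = trans (*-distribʳ-+ c (F x) (∑ xs F)) (cong (F x * c +_) (*-distribʳ-∑ c F xs))

  ∑-++ : (F : A → ℕ) (xs ys : List A) → ∑ (xs ++ ys) F ≡ ∑ xs F + ∑ ys F
  ∑-++ F xs ys = trans (cong sum (map-++ F xs ys)) (sum-++ (map F xs) (map F ys))

module _ {A B : Set} where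

  ∑-map : (F : B → ℕ) (g : A → B) (xs : List A) → ∑ (map g xs) F ≡ ∑[ x ∈ xs ] F (g x)
  ∑-map F g xs = cong sum (sym (map-∘ xs))

  ∑-concatMap : (F : B → ℕ) (g : A → List B) (xs : List A) →
    ∑ (concatMap g xs) F ≡ ∑[ x ∈ xs ] ∑ (g x) F
  ∑-concatMap F g []       = refl
  ∑-concatMap F g (x ∷ xs) = trans (∑-++ F (g x) (concatMap g xs)) (cong (∑ (g x) F +_) (∑-concatMap F g xs))

  ∑-comm : (F : A → B → ℕ) (xs : List A) (ys : List B) →
    ∑[ y ∈ ys ] ∑[ x ∈ xs ] F x y ≡ ∑[ x ∈ xs ] ∑[ y ∈ ys ] F x y
  ∑-comm F xs []       = sym (∑-zero xs)
  ∑-comm F xs (y ∷ ys) = begin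
    (∑[ x ∈ xs ] F x y) + (∑[ y′ ∈ ys ] ∑[ x ∈ xs ] F x y′)
      ≡⟨ cong ((∑[ x ∈ xs ] F x y) +_) (∑-comm F xs ys) ⟩
    (∑[ x ∈ xs ] F x y) + (∑[ x ∈ xs ] ∑[ y′ ∈ ys ] F x y′)
      ≡⟨ ∑-distrib-+ (λ x → F x y) (λ x → ∑[ y′ ∈ ys ] F x y′) xs ⟨
    ∑[ x ∈ xs ] (F x y + (∑[ y′ ∈ ys ] F x y′)) ∎

∑-applyUpTo : (F : ℕ → ℕ) (f : ℕ → ℕ) (n : ℕ) → ∑ (applyUpTo f n) F ≡ ∑[ i ∈ upTo n ] F (f i)
∑-applyUpTo F f n = trans (cong (λ is → ∑ is F) (sym (map-upTo f n))) (∑-map F f (upTo n))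

∑-upTo-vanishing : ∀ {K′ K} (F : ℕ → ℕ) → (∀ a → K′ < a → F a ≡ 0) → K′ ≤′ K →
  ∑ [ K ] F ≡ ∑ [ K′ ] F
∑-upTo-vanishing F F≡0 ≤′-refl = refl
∑-upTo-vanishing {K′} F F≡0 (≤′-step {K} K′≤′K) = begin
  ∑ [ suc K ] F               ≡⟨ cong (λ is → ∑ is F) (applyUpTo-∷ʳ suc K) ⟨
  ∑ ([ K ] ∷ʳ suc K) F        ≡⟨ ∑-++ F [ K ] (suc K ∷ []) ⟩
  ∑ [ K ] F + (F (suc K) + 0) ≡⟨ cong (λ y → ∑ [ K ] F + (y + 0)) (F≡0 (suc K) (s≤s (≤′⇒≤ K′≤′K))) ⟩
  ∑ [ K ] F + 0               ≡⟨ +-identityʳ _ ⟩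
  ∑ [ K ] F                   ≡⟨ ∑-upTo-vanishing F F≡0 K′≤′K ⟩
  ∑ [ K′ ] F                  ∎

All-applyUpTo-map : {P Q : ℕ → Set} {f g : ℕ → ℕ} → (∀ i → P (f i) → Q (g i)) →
  ∀ n → All P (applyUpTo f n) → All Q (applyUpTo g n)
All-applyUpTo-map PQ zero    []       = []
All-applyUpTo-map PQ (suc n) (p ∷ ps) = PQ 0 p ∷ All-applyUpTo-map (PQ ∘ suc) n ps

∑-words-suc : ∀ m K (F : List ℕ → ℕ) →
  ∑ (words (suc m) K) F ≡ ∑[ a ∈ [ K ] ] ∑[ w ∈ words m K ] F (a ∷ w)
∑-words-suc m K F = begin
  ∑ (words (suc m) K) F                       ≡⟨ ∑-concatMap F (λ w → map (_∷ w) [ K ]) (words m K) ⟩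
  ∑[ w ∈ words m K ] ∑ (map (_∷ w) [ K ]) F   ≡⟨ ∑-cong (λ w → ∑-map F (_∷ w) [ K ]) (words m K) ⟩
  ∑[ w ∈ words m K ] ∑[ a ∈ [ K ] ] F (a ∷ w) ≡⟨ ∑-comm (λ a w → F (a ∷ w)) [ K ] (words m K) ⟩
  ∑[ a ∈ [ K ] ] ∑[ w ∈ words m K ] F (a ∷ w) ∎

∑-words-cong : ∀ m K {F G : List ℕ → ℕ} → (∀ w → length w ≡ m → F w ≡ G w) →
  ∑ (words m K) F ≡ ∑ (words m K) G
∑-words-cong zero    K F≗G = cong (_+ 0) (F≗G [] refl)
∑-words-cong (suc m) K {F} {G} F≗G = begin
  ∑ (words (suc m) K) F
    ≡⟨ ∑-words-suc m K F ⟩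
  ∑[ a ∈ [ K ] ] ∑[ w ∈ words m K ] F (a ∷ w)
    ≡⟨ ∑-cong (λ a → ∑-words-cong m K (λ w → F≗G (a ∷ w) ∘ cong suc)) [ K ] ⟩
  ∑[ a ∈ [ K ] ] ∑[ w ∈ words m K ] G (a ∷ w)
    ≡⟨ ∑-words-suc m K G ⟨
  ∑ (words (suc m) K) G ∎

∑-words-vanishing : ∀ m K {F : List ℕ → ℕ} → (∀ w → length w ≡ m → F w ≡ 0) → ∑ (words m K) F ≡ 0
∑-words-vanishing m K F≡0 = trans (∑-words-cong m K F≡0) (∑-zero (words m K))

∑-words-alphabet : ∀ m {K′ K} (F : List ℕ → ℕ) → K′ ≤ K →
  (∀ w → length w ≡ m → Any (K′ <_) w → F w ≡ 0) → ∑ (words m K) F ≡ ∑ (words m K′) F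
∑-words-alphabet zero    F K′≤K F≡0 = refl
∑-words-alphabet (suc m) {K′} {K} F K′≤K F≡0 = begin
  ∑ (words (suc m) K) F                         ≡⟨ ∑-words-suc m K F ⟩
  ∑[ a ∈ [ K ] ] ∑[ w ∈ words m K ] F (a ∷ w)   ≡⟨ ∑-cong shrinkTail [ K ] ⟩
  ∑[ a ∈ [ K ] ] ∑[ w ∈ words m K′ ] F (a ∷ w)  ≡⟨ ∑-upTo-vanishing _ bigLetter (≤⇒≤′ K′≤K) ⟩
  ∑[ a ∈ [ K′ ] ] ∑[ w ∈ words m K′ ] F (a ∷ w) ≡⟨ ∑-words-suc m K′ F ⟨
  ∑ (words (suc m) K′) F                        ∎
  where
  bigLetter : ∀ a → K′ < a → ∑[ w ∈ words m K′ ] F (a ∷ w) ≡ 0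
  bigLetter a K′<a = ∑-words-vanishing m K′ (λ w ∣w∣≡m → F≡0 (a ∷ w) (cong suc ∣w∣≡m) (here K′<a))
  shrinkTail : ∀ a → ∑[ w ∈ words m K ] F (a ∷ w) ≡ ∑[ w ∈ words m K′ ] F (a ∷ w)
  shrinkTail a with K′ <? a
  ... | yes K′<a = trans (∑-words-vanishing m K (λ w ∣w∣≡m → F≡0 (a ∷ w) (cong suc ∣w∣≡m) (here K′<a)))
                         (sym (bigLetter a K′<a))
  ... | no _     = ∑-words-alphabet m (F ∘ (a ∷_)) K′≤K (λ w ∣w∣≡m → F≡0 (a ∷ w) (cong suc ∣w∣≡m) ∘ there)

m<o≤m⊔n⇒o≤n : ∀ {m n o} → m < o → o ≤ m ⊔ n → o ≤ n
m<o≤m⊔n⇒o≤n {m} {n} m<o o≤m⊔n with ⊔-sel m n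
... | inj₁ m⊔n≡m = contradiction (subst (_ ≤_) m⊔n≡m o≤m⊔n) (<⇒≱ m<o)
... | inj₂ m⊔n≡n = subst (_ ≤_) m⊔n≡n o≤m⊔n

-- For m ≤ k truncated subtraction makes the arguments of h differ, but then m C suc k = 0.
C-suc-absorbs-∸ : ∀ m k (h : ℕ → ℕ) → (m C suc k) * h (suc (m ∸ suc k)) ≡ (m C suc k) * h (m ∸ k)
C-suc-absorbs-∸ m k h with k <? m
... | yes k<m = cong (λ j → (m C suc k) * h j) (sym (+-∸-assoc 1 k<m))
... | no  k≮m rewrite k>n⇒nCk≡0 {m} {suc k} (s≤s (≮⇒≥ k≮m)) = refl

∑-𝟙-0≟ : ∀ m → ∑[ k ∈ [ m ] ] 𝟙 (0 ≟ k) ≡ 0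
∑-𝟙-0≟ m = trans (∑-applyUpTo _ suc m) (∑-zero (upTo m))

∑-𝟙-suc-≟ : ∀ o m → ∑[ k ∈ [ m ] ] 𝟙 (suc o ≟ k) ≡ ∑[ i ∈ upTo m ] 𝟙 (o ≟ i)
∑-𝟙-suc-≟ o m = trans (∑-applyUpTo _ suc m) (∑-cong (𝟙-≟-suc o) (upTo m))

∑-upTo-𝟙-≟ : ∀ {o m} → o < m → ∑[ i ∈ upTo m ] 𝟙 (o ≟ i) ≡ 1
∑-upTo-𝟙-≟ {zero}  {suc m} _         = cong suc (∑-𝟙-0≟ m)
∑-upTo-𝟙-≟ {suc o} {suc m} (s≤s o<m) = trans (∑-𝟙-suc-≟ o m) (∑-upTo-𝟙-≟ o<m)

𝟙-positive≡∑ : ∀ {o m} → o ≤ m → 𝟙 (1 ≤? o) ≡ ∑[ k ∈ [ m ] ] 𝟙 (o ≟ k)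
𝟙-positive≡∑ {zero}  {m} _   = sym (∑-𝟙-0≟ m)
𝟙-positive≡∑ {suc o} {m} o<m = sym (trans (∑-𝟙-suc-≟ o m) (∑-upTo-𝟙-≟ o<m))

∑-words-partition : ∀ m K (h G : List ℕ → ℕ) → (∀ w → h w ≤ length w) →
  ∑[ w ∈ words m K ] 𝟙 (1 ≤? h w) * G w ≡ ∑[ k ∈ [ m ] ] ∑[ w ∈ words m K ] 𝟙 (h w ≟ k) * G w
∑-words-partition m K h G h≤length = begin
  ∑[ w ∈ words m K ] 𝟙 (1 ≤? h w) * G w
    ≡⟨ ∑-words-cong m K split ⟩
  ∑[ w ∈ words m K ] ∑[ k ∈ [ m ] ] 𝟙 (h w ≟ k) * G w
    ≡⟨ ∑-comm (λ k w → 𝟙 (h w ≟ k) * G w) [ m ] (words m K) ⟩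
  ∑[ k ∈ [ m ] ] ∑[ w ∈ words m K ] 𝟙 (h w ≟ k) * G w ∎
  where
  split : ∀ w → length w ≡ m → 𝟙 (1 ≤? h w) * G w ≡ ∑[ k ∈ [ m ] ] 𝟙 (h w ≟ k) * G w
  split w ∣w∣≡m = trans (cong (_* G w) (𝟙-positive≡∑ (subst (h w ≤_) ∣w∣≡m (h≤length w))))
                        (*-distribʳ-∑ (G w) (λ k → 𝟙 (h w ≟ k)) [ m ])

multiplicity : ℕ → List ℕ → ℕ
multiplicity a w = ∑[ x ∈ w ] 𝟙 (x ≟ a)

multiplicity≤length : ∀ a w → multiplicity a w ≤ length w
multiplicity≤length a []      = z≤n
multiplicity≤length a (x ∷ w) with x ≟ a
... | yes _ = s≤s (multiplicity≤length a w)
... | no _  = m≤n⇒m≤1+n (multiplicity≤length a w)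

deleteOnes : List ℕ → List ℕ
deleteOnes []                = []
deleteOnes (zero ∷ w)        = zero ∷ deleteOnes w
deleteOnes (suc zero ∷ w)    = deleteOnes w
deleteOnes (suc (suc a) ∷ w) = suc a ∷ deleteOnes w

∑-exactly-k-ones : ∀ m K k (G : List ℕ → ℕ) →
  ∑[ w ∈ words m (suc K) ] 𝟙 (multiplicity 1 w ≟ k) * G (deleteOnes w) ≡ (m C k) * ∑ (words (m ∸ k) K) G
∑-exactly-k-ones zero    K zero    G = refl
∑-exactly-k-ones zero    K (suc k) G = refl
∑-exactly-k-ones (suc m) K k       G = begin
  ∑ (words (suc m) (suc K)) (H k G)
    ≡⟨ ∑-words-suc m (suc K) (H k G) ⟩
  leadingOne k + (∑[ a ∈ applyUpTo (suc ∘ suc) K ] ∑[ w ∈ words m (suc K) ] H k G (a ∷ w))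
    ≡⟨ cong (leadingOne k +_) (higherLetters k) ⟩
  leadingOne k + (m C k) * ∑ (words (suc (m ∸ k)) K) G
    ≡⟨ pascal k ⟩
  (suc m C k) * ∑ (words (suc m ∸ k) K) G ∎
  where
  H : ℕ → (List ℕ → ℕ) → List ℕ → ℕ
  H k F w = 𝟙 (multiplicity 1 w ≟ k) * F (deleteOnes w)

  leadingOne : ℕ → ℕ
  leadingOne k = ∑[ w ∈ words m (suc K) ] 𝟙 (suc (multiplicity 1 w) ≟ k) * G (deleteOnes w)

  higherLetters : ∀ k → ∑[ a ∈ applyUpTo (suc ∘ suc) K ] ∑[ w ∈ words m (suc K) ] H k G (a ∷ w)
                        ≡ (m C k) * ∑ (words (suc (m ∸ k)) K) G
  higherLetters k = begin
    ∑[ a ∈ applyUpTo (suc ∘ suc) K ] ∑[ w ∈ words m (suc K) ] H k G (a ∷ w)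
      ≡⟨ ∑-applyUpTo _ (suc ∘ suc) K ⟩
    ∑[ b ∈ upTo K ] ∑[ w ∈ words m (suc K) ] H k (G ∘ (suc b ∷_)) w
      ≡⟨ ∑-cong (λ b → ∑-exactly-k-ones m K k (G ∘ (suc b ∷_))) (upTo K) ⟩
    ∑[ b ∈ upTo K ] (m C k) * (∑[ g ∈ words (m ∸ k) K ] G (suc b ∷ g))
      ≡⟨ *-distribˡ-∑ (m C k) _ (upTo K) ⟨
    (m C k) * (∑[ b ∈ upTo K ] ∑[ g ∈ words (m ∸ k) K ] G (suc b ∷ g))
      ≡⟨ cong ((m C k) *_) (sym (∑-applyUpTo _ suc K)) ⟩
    (m C k) * (∑[ a ∈ [ K ] ] ∑[ g ∈ words (m ∸ k) K ] G (a ∷ g))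
      ≡⟨ cong ((m C k) *_) (∑-words-suc (m ∸ k) K G) ⟨
    (m C k) * ∑ (words (suc (m ∸ k)) K) G ∎

  pascal : ∀ k → leadingOne k + (m C k) * ∑ (words (suc (m ∸ k)) K) G
                 ≡ (suc m C k) * ∑ (words (suc m ∸ k) K) G
  pascal zero    = cong (_+ (m C 0) * ∑ (words (suc m) K) G) (∑-zero (words m (suc K)))
  pascal (suc k) = begin
    leadingOne (suc k) + (m C suc k) * ∑ (words (suc (m ∸ suc k)) K) G
      ≡⟨ cong₂ _+_ (trans (∑-cong (λ w → cong (_* G (deleteOnes w)) (𝟙-≟-suc (multiplicity 1 w) k))
                                  (words m (suc K)))
                          (∑-exactly-k-ones m K k G))
                   (C-suc-absorbs-∸ m k (λ j → ∑ (words j K) G)) ⟩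
    (m C k) * X + (m C suc k) * X
      ≡⟨ *-distribʳ-+ X (m C k) (m C suc k) ⟨
    (m C k + m C suc k) * X
      ≡⟨ cong (_* X) (nCk+nC[k+1]≡[n+1]C[k+1] m k) ⟩
    (suc m C suc k) * X ∎
    where
    X : ℕ
    X = ∑ (words (m ∸ k) K) G

maximum : List ℕ → ℕ
maximum = foldr _⊔_ 0

GrowsFrom : ℕ → List ℕ → Set
GrowsFrom M []      = ⊤
GrowsFrom M (x ∷ f) = (1 ≤ x × x ≤ suc M) × GrowsFrom (M ⊔ x) f

at-∷-positions : ∀ x f n → map (at (x ∷ f)) (applyUpTo (suc ∘ suc) n) ≡ map (at f) [ n ]
at-∷-positions x f n = trans (map-applyUpTo (suc ∘ suc) (at (x ∷ f)) n) (sym (map-applyUpTo suc (at f) n))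

map-at-positions : ∀ f → map (at f) [ length f ] ≡ f
map-at-positions []      = refl
map-at-positions (x ∷ f) = cong (x ∷_) (trans (at-∷-positions x f (length f)) (map-at-positions f))

maxBefore-∷ : ∀ x f i → maxBefore (x ∷ f) (suc (suc i)) ≡ x ⊔ maxBefore f (suc i)
maxBefore-∷ x f i = cong (x ⊔_) (begin
  foldr (λ j m → at (x ∷ f) j ⊔ m) 0 (applyUpTo (suc ∘ suc) i)
    ≡⟨ foldr-map _⊔_ (at (x ∷ f)) 0 (applyUpTo (suc ∘ suc) i) ⟨
  maximum (map (at (x ∷ f)) (applyUpTo (suc ∘ suc) i))
    ≡⟨ cong maximum (at-∷-positions x f i) ⟩
  maximum (map (at f) [ i ])
    ≡⟨ foldr-map _⊔_ (at f) 0 [ i ] ⟩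
  foldr (λ j m → at f j ⊔ m) 0 [ i ] ∎)

occ≡multiplicity : ∀ f a → occ f a ≡ multiplicity a f
occ≡multiplicity f a = begin
  occ f a                                       ≡⟨ length-filter≡∑𝟙 (λ k → at f k ≟ a) [ length f ] ⟩
  ∑[ k ∈ [ length f ] ] 𝟙 (at f k ≟ a)          ≡⟨ ∑-map (λ x → 𝟙 (x ≟ a)) (at f) [ length f ] ⟨
  ∑[ x ∈ map (at f) [ length f ] ] 𝟙 (x ≟ a)    ≡⟨ cong (multiplicity a) (map-at-positions f) ⟩
  multiplicity a f                              ∎

IsRGFAfter : ℕ → List ℕ → Set
IsRGFAfter M f = All (λ i → (1 ≤ at f i) × (at f i ≤ suc (M ⊔ maxBefore f i))) [ length f ]

⊔-maxBefore-∷ : ∀ M x f i → M ⊔ maxBefore (x ∷ f) (suc (suc i)) ≡ M ⊔ x ⊔ maxBefore f (suc i)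
⊔-maxBefore-∷ M x f i = trans (cong (M ⊔_) (maxBefore-∷ x f i)) (sym (⊔-assoc M x _))

IsRGFAfter⇒GrowsFrom : ∀ M f → IsRGFAfter M f → GrowsFrom M f
IsRGFAfter⇒GrowsFrom M []      _ = _
IsRGFAfter⇒GrowsFrom M (x ∷ f) ((1≤x , x≤1+M⊔0) ∷ ps) =
  (1≤x , subst (λ y → x ≤ suc y) (⊔-identityʳ M) x≤1+M⊔0) ,
  IsRGFAfter⇒GrowsFrom (M ⊔ x) f
    (All-applyUpTo-map (λ i (p , q) → p , subst (λ y → at f (suc i) ≤ suc y) (⊔-maxBefore-∷ M x f i) q)
                       (length f) ps)

GrowsFrom⇒IsRGFAfter : ∀ M f → GrowsFrom M f → IsRGFAfter M f
GrowsFrom⇒IsRGFAfter M []      _ = []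
GrowsFrom⇒IsRGFAfter M (x ∷ f) ((1≤x , x≤1+M) , g) =
  (1≤x , subst (λ y → x ≤ suc y) (sym (⊔-identityʳ M)) x≤1+M) ∷
  All-applyUpTo-map (λ i (p , q) → p , subst (λ y → at f (suc i) ≤ suc y) (sym (⊔-maxBefore-∷ M x f i)) q)
                    (length f) (GrowsFrom⇒IsRGFAfter (M ⊔ x) f g)

IsRGF⇔GrowsFrom : ∀ f → IsRGF f ⇔ GrowsFrom 0 f
IsRGF⇔GrowsFrom []      = mk⇔ (λ _ → _) (λ _ → refl)
IsRGF⇔GrowsFrom (x ∷ f) = mk⇔ (IsRGFAfter⇒GrowsFrom 0 (x ∷ f) ∘ proj₂)
  (λ g@((1≤x , x≤1) , _) → ≤-antisym x≤1 1≤x , GrowsFrom⇒IsRGFAfter 0 (x ∷ f) g)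

at≤maximum : ∀ f i → at f i ≤ maximum f
at≤maximum []      i             = z≤n
at≤maximum (x ∷ f) zero          = z≤n
at≤maximum (x ∷ f) (suc zero)    = m≤m⊔n x (maximum f)
at≤maximum (x ∷ f) (suc (suc i)) = ≤-trans (at≤maximum f (suc i)) (m≤n⊔m x (maximum f))

maximum-++ : ∀ p q → maximum (p ++ q) ≡ maximum p ⊔ maximum q
maximum-++ []      q = refl
maximum-++ (x ∷ p) q = trans (cong (x ⊔_) (maximum-++ p q)) (sym (⊔-assoc x (maximum p) (maximum q)))

<maximum⇒∃at : ∀ {v} s → v < maximum s → ∃ λ k → k < length s × v < at s (suc k)
<maximum⇒∃at {v} (x ∷ s) v<max with v <? x
... | yes v<x = 0 , s≤s z≤n , v<x
... | no  v≮x with k , k<∣s∣ , v<sₖ ← <maximum⇒∃at s (m<o≤m⊔n⇒o≤n (s≤s (≮⇒≥ v≮x)) v<max)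
    = suc k , s≤s k<∣s∣ , v<sₖ

GrowsFrom-∈ : ∀ {M v} f → GrowsFrom M f → M < v → v ≤ maximum f → v ∈ f
GrowsFrom-∈ []      _ () z≤n
GrowsFrom-∈ {M} {v} (x ∷ f) ((_ , x≤1+M) , g) M<v v≤max with v ≤? M ⊔ x
... | yes v≤M⊔x = here (≤-antisym (m<o≤m⊔n⇒o≤n M<v v≤M⊔x) (≤-trans x≤1+M M<v))
... | no  v≰M⊔x = there (GrowsFrom-∈ f g (≰⇒> v≰M⊔x) (m<o≤m⊔n⇒o≤n (m⊔n<o⇒n<o M x (≰⇒> v≰M⊔x)) v≤max))

GrowsFrom-++ˡ : ∀ M p q → GrowsFrom M (p ++ q) → GrowsFrom M p
GrowsFrom-++ˡ M []      q _       = _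
GrowsFrom-++ˡ M (x ∷ p) q (b , g) = b , GrowsFrom-++ˡ (M ⊔ x) p q g

∈⇒1≤multiplicity : ∀ {v} p → v ∈ p → 1 ≤ multiplicity v p
∈⇒1≤multiplicity {v} (x ∷ p) (here v≡x) =
  subst (λ c → 1 ≤ c + multiplicity v p) (sym (𝟙-true (x ≟ v) (sym v≡x))) (s≤s z≤n)
∈⇒1≤multiplicity {v} (x ∷ p) (there v∈p) = ≤-trans (∈⇒1≤multiplicity p v∈p) (m≤n+m _ _)

multiplicity-++-∷ : ∀ v p s → multiplicity v (p ++ v ∷ s) ≡ multiplicity v p + suc (multiplicity v s)
multiplicity-++-∷ v p s = trans (∑-++ (λ x → 𝟙 (x ≟ v)) p (v ∷ s))
  (cong (λ c → multiplicity v p + (c + multiplicity v s)) (𝟙-true (v ≟ v) refl))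

at-++ˡ : ∀ p q {k} → k < length p → at (p ++ q) (suc k) ≡ at p (suc k)
at-++ˡ (x ∷ p) q {zero}  _           = refl
at-++ˡ (x ∷ p) q {suc k} (s≤s k<∣p∣) = at-++ˡ p q k<∣p∣

at-++ʳ : ∀ p q k → at (p ++ q) (suc (length p + k)) ≡ at q (suc k)
at-++ʳ []      q k = refl
at-++ʳ (x ∷ p) q k = at-++ʳ p q k

at-++-∷ : ∀ p v s → at (p ++ v ∷ s) (suc (length p)) ≡ v
at-++-∷ []      v s = refl
at-++-∷ (x ∷ p) v s = at-++-∷ p v s

InLrMax-++-∷ : ∀ p v s → maximum p < v → InLrMax (p ++ v ∷ s) (suc (length p))
InLrMax-++-∷ p v s max<v = applyUpTo⁺₁ suc (length p) λ j<∣p∣ →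
  ≤-<-trans (≤-trans (≤-reflexive (at-++ˡ p (v ∷ s) j<∣p∣)) (at≤maximum p _))
            (subst (maximum p <_) (sym (at-++-∷ p v s)) max<v)

RepeatedBelowMaximum : List ℕ → Set
RepeatedBelowMaximum f = ∀ v → 1 ≤ v → v < maximum f → 2 ≤ multiplicity v f

Good′ : List ℕ → Set
Good′ f = GrowsFrom 0 f × RepeatedBelowMaximum f

repeated⇒u≡0 : ∀ f → IsRGF f → RepeatedBelowMaximum f → All (λ i → u f i ≡ 0) [ length f ]
repeated⇒u≡0 []          _             _   = []
repeated⇒u≡0 f@(_ ∷ _) (_ , letters) rep = applyUpTo⁺₁ suc (length f) λ {i} i<∣f∣ →
  cong length (filter-none (counted? f (suc i)) (applyUpTo⁺₁ suc i λ {j} j<i (_ , once , fⱼ<fᵢ) →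
    let twice = rep (at f (suc j)) (proj₁ (applyUpTo⁻ suc (length f) letters (<-trans j<i i<∣f∣)))
                    (<-≤-trans fⱼ<fᵢ (at≤maximum f (suc i)))
    in  <⇒≱ twice (≤-reflexive (trans (sym (occ≡multiplicity f _)) once))))

larger-after-unique⇒u≢0 : ∀ p v s → maximum p < v → multiplicity v p + multiplicity v s ≡ 0 →
  (∃ λ k → k < length s × v < at s (suc k)) → let f = p ++ v ∷ s in ¬ All (λ i → u f i ≡ 0) [ length f ]
larger-after-unique⇒u≢0 p v s max-p<v absent (k , k<∣s∣ , v<sₖ) u≡0 =
  <⇒≢ (filter-some (counted? f (suc i)) (applyUpTo⁺ suc counted (m<m+n (length p) z<s))) (sym uᵢ≡0)
  where
  f : List ℕ
  f = p ++ v ∷ s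
  i : ℕ
  i = length p + suc k
  counted : Counted f (suc i) (suc (length p))
  counted = InLrMax-++-∷ p v s max-p<v
          , trans (cong (occ f) (at-++-∷ p v s))
                  (trans (occ≡multiplicity f v)
                         (trans (multiplicity-++-∷ v p s) (trans (+-suc _ _) (cong suc absent))))
          , subst₂ _<_ (sym (at-++-∷ p v s)) (sym (at-++ʳ p (v ∷ s) (suc k))) v<sₖ
  uᵢ≡0 : u f (suc i) ≡ 0
  uᵢ≡0 = applyUpTo⁻ suc (length f) u≡0 (subst (i <_) (sym (length-++ p)) (+-monoʳ-< (length p) (s≤s k<∣s∣)))

once-below-maximum⇒u≢0 : ∀ p v s → let f = p ++ v ∷ s in
  GrowsFrom 0 f → 1 ≤ v → multiplicity v f ≤ 1 → v < maximum f → ¬ All (λ i → u f i ≡ 0) [ length f ]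
once-below-maximum⇒u≢0 p v s g 1≤v once v<max =
  larger-after-unique⇒u≢0 p v s max-p<v absent (<maximum⇒∃at s v<max-s)
  where
  absent : multiplicity v p + multiplicity v s ≡ 0
  absent = n≤0⇒n≡0 (s≤s⁻¹ (subst (_≤ 1) (trans (multiplicity-++-∷ v p s) (+-suc _ _)) once))
  max-p<v : maximum p < v
  max-p<v = ≰⇒> λ v≤max-p →
    <⇒≢ (∈⇒1≤multiplicity p (GrowsFrom-∈ p (GrowsFrom-++ˡ 0 p (v ∷ s) g) 1≤v v≤max-p)) (sym (m+n≡0⇒m≡0 _ absent))
  v<max-s : v < maximum s
  v<max-s = m<o≤m⊔n⇒o≤n ≤-refl (m<o≤m⊔n⇒o≤n (m<n⇒m<1+n max-p<v) (subst (v <_) (maximum-++ p (v ∷ s)) v<max))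

u≡0⇒repeated : ∀ f → GrowsFrom 0 f → All (λ i → u f i ≡ 0) [ length f ] → RepeatedBelowMaximum f
u≡0⇒repeated f g u≡0 v 1≤v v<max with 2 ≤? multiplicity v f
... | yes twice  = twice
... | no  ¬twice with p , s , refl ← ∈-∃++ (GrowsFrom-∈ f g 1≤v (<⇒≤ v<max))
    = contradiction u≡0 (once-below-maximum⇒u≢0 p v s g 1≤v (s≤s⁻¹ (≰⇒> ¬twice)) v<max)

Good⇔Good′ : ∀ f → Good f ⇔ Good′ f
Good⇔Good′ f = mk⇔
  (λ (rgf , u≡0) → let g = Equivalence.to (IsRGF⇔GrowsFrom f) rgf in g , u≡0⇒repeated f g u≡0)
  (λ (g , rep) → let rgf = Equivalence.from (IsRGF⇔GrowsFrom f) g in rgf , repeated⇒u≡0 f rgf rep)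

GrowsFrom-deleteOnes⁺ : ∀ M w → GrowsFrom (suc M) w → GrowsFrom M (deleteOnes w)
GrowsFrom-deleteOnes⁺ M []                _                          = _
GrowsFrom-deleteOnes⁺ M (zero ∷ w)        ((() , _) , _)
GrowsFrom-deleteOnes⁺ M (suc zero ∷ w)    (_ , g)                    =
  GrowsFrom-deleteOnes⁺ M w (subst (λ N → GrowsFrom (suc N) w) (⊔-identityʳ M) g)
GrowsFrom-deleteOnes⁺ M (suc (suc b) ∷ w) ((_ , s≤s 1+b≤1+M) , g) =
  (s≤s z≤n , 1+b≤1+M) , GrowsFrom-deleteOnes⁺ (M ⊔ suc b) w g

GrowsFrom-deleteOnes⁻ : ∀ M w → GrowsFrom M (deleteOnes w) → GrowsFrom (suc M) w
GrowsFrom-deleteOnes⁻ M []                _                     = _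
GrowsFrom-deleteOnes⁻ M (zero ∷ w)        ((() , _) , _)
GrowsFrom-deleteOnes⁻ M (suc zero ∷ w)    g                     =
  (≤-refl , s≤s z≤n) , subst (λ N → GrowsFrom (suc N) w) (sym (⊔-identityʳ M)) (GrowsFrom-deleteOnes⁻ M w g)
GrowsFrom-deleteOnes⁻ M (suc (suc b) ∷ w) ((_ , 1+b≤1+M) , g) =
  (s≤s z≤n , s≤s 1+b≤1+M) , GrowsFrom-deleteOnes⁻ (M ⊔ suc b) w g

1⊔maximum≡suc-maximum-deleteOnes : ∀ w → 1 ⊔ maximum w ≡ suc (maximum (deleteOnes w))
1⊔maximum≡suc-maximum-deleteOnes []                = refl
1⊔maximum≡suc-maximum-deleteOnes (zero ∷ w)        = 1⊔maximum≡suc-maximum-deleteOnes w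
1⊔maximum≡suc-maximum-deleteOnes (suc zero ∷ w)    =
  trans (sym (⊔-assoc 1 1 (maximum w))) (1⊔maximum≡suc-maximum-deleteOnes w)
1⊔maximum≡suc-maximum-deleteOnes (suc (suc b) ∷ w) = begin
  1 ⊔ (suc (suc b) ⊔ maximum w) ≡⟨ ⊔-assoc 1 (suc (suc b)) (maximum w) ⟨
  suc (suc b) ⊔ 1 ⊔ maximum w   ≡⟨ ⊔-assoc (suc (suc b)) 1 (maximum w) ⟩
  suc (suc b) ⊔ (1 ⊔ maximum w) ≡⟨ cong (suc (suc b) ⊔_) (1⊔maximum≡suc-maximum-deleteOnes w) ⟩
  suc (suc b ⊔ maximum (deleteOnes w)) ∎

multiplicity-deleteOnes : ∀ v w → multiplicity (suc (suc v)) w ≡ multiplicity (suc v) (deleteOnes w)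
multiplicity-deleteOnes v []                = refl
multiplicity-deleteOnes v (zero ∷ w)        = multiplicity-deleteOnes v w
multiplicity-deleteOnes v (suc zero ∷ w)    = multiplicity-deleteOnes v w
multiplicity-deleteOnes v (suc (suc b) ∷ w) = cong₂ _+_ (𝟙-≟-suc (suc b) (suc v)) (multiplicity-deleteOnes v w)

Good′-1∷⇔ : ∀ w → 1 ≤ length w → Good′ (1 ∷ w) ⇔ (1 ≤ multiplicity 1 w × Good′ (deleteOnes w))
Good′-1∷⇔ w 1≤∣w∣ = mk⇔ to from
  where
  to : Good′ (1 ∷ w) → 1 ≤ multiplicity 1 w × Good′ (deleteOnes w)
  to ((_ , g) , rep) = hasOne w 1≤∣w∣ g rep , GrowsFrom-deleteOnes⁺ 0 w g , rep′
    where
    hasOne : ∀ w → 1 ≤ length w → GrowsFrom 1 w → RepeatedBelowMaximum (1 ∷ w) → 1 ≤ multiplicity 1 w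
    hasOne []                () _ _
    hasOne (zero ∷ w)        _ ((() , _) , _) _
    hasOne (suc zero ∷ w)    _ _ _ = s≤s z≤n
    hasOne (suc (suc b) ∷ w) _ _ rep =
      s≤s⁻¹ (rep 1 ≤-refl (m≤n⇒m≤o⊔n 1 (m≤n⇒m≤n⊔o (maximum w) (s≤s (s≤s (z≤n {b}))))))
    rep′ : RepeatedBelowMaximum (deleteOnes w)
    rep′ zero    ()
    rep′ (suc v) _ v<max = subst (2 ≤_) (multiplicity-deleteOnes v w)
      (rep (suc (suc v)) (s≤s z≤n) (subst (suc (suc v) <_) (sym (1⊔maximum≡suc-maximum-deleteOnes w)) (s≤s v<max)))
  from : 1 ≤ multiplicity 1 w × Good′ (deleteOnes w) → Good′ (1 ∷ w)
  from (1≤ones , g , rep′) = ((≤-refl , ≤-refl) , GrowsFrom-deleteOnes⁻ 0 w g) , rep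
    where
    rep : RepeatedBelowMaximum (1 ∷ w)
    rep zero          ()
    rep (suc zero)    _ _     = s≤s 1≤ones
    rep (suc (suc v)) _ v<max = subst (2 ≤_) (sym (multiplicity-deleteOnes v w))
      (rep′ (suc v) (s≤s z≤n) (s≤s⁻¹ (subst (suc (suc v) <_) (1⊔maximum≡suc-maximum-deleteOnes w) v<max)))

𝟙-good?-1∷ : ∀ w → 1 ≤ length w → 𝟙 (good? (1 ∷ w)) ≡ 𝟙 (1 ≤? multiplicity 1 w) * 𝟙 (good? (deleteOnes w))
𝟙-good?-1∷ w 1≤∣w∣ =
  trans (𝟙-cong (good? (1 ∷ w)) ((1 ≤? multiplicity 1 w) ×-dec good? (deleteOnes w)) (mk⇔ split merge))
        (𝟙-×-dec (1 ≤? multiplicity 1 w) (good? (deleteOnes w)))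
  where
  open Equivalence using (to; from)
  split : Good (1 ∷ w) → 1 ≤ multiplicity 1 w × Good (deleteOnes w)
  split good with ones , good′ ← to (Good′-1∷⇔ w 1≤∣w∣) (to (Good⇔Good′ (1 ∷ w)) good)
    = ones , from (Good⇔Good′ (deleteOnes w)) good′
  merge : 1 ≤ multiplicity 1 w × Good (deleteOnes w) → Good (1 ∷ w)
  merge (ones , good) =
    from (Good⇔Good′ (1 ∷ w)) (from (Good′-1∷⇔ w 1≤∣w∣) (ones , to (Good⇔Good′ (deleteOnes w)) good))

maximum≤+length : ∀ M w → GrowsFrom M w → maximum w ≤ M + length w
maximum≤+length M []      _                  = z≤n
maximum≤+length M (x ∷ w) ((_ , x≤1+M) , g) = ≤-trans
  (⊔-lub (≤-trans x≤1+M (s≤s (m≤m+n M (length w))))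
         (≤-trans (maximum≤+length (M ⊔ x) w g) (+-monoˡ-≤ (length w) (⊔-lub (n≤1+n M) x≤1+M))))
  (≤-reflexive (sym (+-suc M (length w))))

<-any⇒<maximum : ∀ {n} w → Any (n <_) w → n < maximum w
<-any⇒<maximum (x ∷ w) (here n<x)  = m<n⇒m<n⊔o (maximum w) n<x
<-any⇒<maximum (x ∷ w) (there n<w) = m<n⇒m<o⊔n x (<-any⇒<maximum w n<w)

l≡∑-words : ∀ j K → j ≤ K → l j ≡ ∑[ f ∈ words j K ] 𝟙 (good? f)
l≡∑-words zero    K _   = refl
l≡∑-words (suc j) K j<K = begin
  l (suc j)
    ≡⟨ length-filter≡∑𝟙 good? (words (suc j) (suc j)) ⟩
  ∑[ f ∈ words (suc j) (suc j) ] 𝟙 (good? f)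
    ≡⟨ ∑-words-alphabet (suc j) (λ f → 𝟙 (good? f)) j<K tooLarge ⟨
  ∑[ f ∈ words (suc j) K ] 𝟙 (good? f) ∎
  where
  tooLarge : ∀ w → length w ≡ suc j → Any (suc j <_) w → 𝟙 (good? w) ≡ 0
  tooLarge w ∣w∣≡1+j large = 𝟙-false (good? w) λ good →
    <⇒≱ (<-any⇒<maximum w large)
        (subst (maximum w ≤_) ∣w∣≡1+j (maximum≤+length 0 w (proj₁ (Equivalence.to (Good⇔Good′ w) good))))

¬Good-leading≥2 : ∀ b w → ¬ Good (suc (suc b) ∷ w)
¬Good-leading≥2 b w ((() , _) , _)

∑-good-leading-1 : ∀ m K →
  ∑[ f ∈ words (suc m) (suc K) ] 𝟙 (good? f) ≡ ∑[ w ∈ words m (suc K) ] 𝟙 (good? (1 ∷ w))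
∑-good-leading-1 m K = begin
  ∑[ f ∈ words (suc m) (suc K) ] 𝟙 (good? f)
    ≡⟨ ∑-words-suc m (suc K) (λ f → 𝟙 (good? f)) ⟩
  leadingOne + (∑[ a ∈ applyUpTo (suc ∘ suc) K ] ∑[ w ∈ words m (suc K) ] 𝟙 (good? (a ∷ w)))
    ≡⟨ cong (leadingOne +_) (∑-applyUpTo _ (suc ∘ suc) K) ⟩
  leadingOne + (∑[ b ∈ upTo K ] ∑[ w ∈ words m (suc K) ] 𝟙 (good? (suc (suc b) ∷ w)))
    ≡⟨ cong (leadingOne +_) (∑-cong (λ b → ∑-words-vanishing m (suc K) λ w _ →
                                          𝟙-false (good? (suc (suc b) ∷ w)) (¬Good-leading≥2 b w)) (upTo K)) ⟩
  leadingOne + (∑[ b ∈ upTo K ] 0)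
    ≡⟨ cong (leadingOne +_) (∑-zero (upTo K)) ⟩
  leadingOne + 0
    ≡⟨ +-identityʳ leadingOne ⟩
  leadingOne ∎
  where
  leadingOne : ℕ
  leadingOne = ∑[ w ∈ words m (suc K) ] 𝟙 (good? (1 ∷ w))

l-suc : ∀ m → 1 ≤ m → l (suc m) ≡ ∑[ k ∈ [ m ] ] (m C k) * l (m ∸ k)
l-suc m 1≤m = begin
  l (suc m)
    ≡⟨ l≡∑-words (suc m) (suc m) ≤-refl ⟩
  ∑ (words (suc m) (suc m)) 𝟙good
    ≡⟨ ∑-good-leading-1 m m ⟩
  ∑[ w ∈ words m (suc m) ] 𝟙good (1 ∷ w)
    ≡⟨ ∑-words-cong m (suc m) (λ w ∣w∣≡m → 𝟙-good?-1∷ w (subst (1 ≤_) (sym ∣w∣≡m) 1≤m)) ⟩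
  ∑[ w ∈ words m (suc m) ] 𝟙 (1 ≤? multiplicity 1 w) * 𝟙good (deleteOnes w)
    ≡⟨ ∑-words-partition m (suc m) (multiplicity 1) (𝟙good ∘ deleteOnes) (multiplicity≤length 1) ⟩
  ∑[ k ∈ [ m ] ] ∑[ w ∈ words m (suc m) ] 𝟙 (multiplicity 1 w ≟ k) * 𝟙good (deleteOnes w)
    ≡⟨ ∑-cong (λ k → ∑-exactly-k-ones m m k 𝟙good) [ m ] ⟩
  ∑[ k ∈ [ m ] ] (m C k) * ∑ (words (m ∸ k) m) 𝟙good
    ≡⟨ ∑-cong (λ k → cong ((m C k) *_) (sym (l≡∑-words (m ∸ k) m (m∸n≤m m k)))) [ m ] ⟩
  ∑[ k ∈ [ m ] ] (m C k) * l (m ∸ k) ∎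
  where
  𝟙good : List ℕ → ℕ
  𝟙good f = 𝟙 (good? f)

theorem19 : (n : ℕ) → 2 ≤ n →
    l n ≡ sum (map (λ k → ((n ∸ 1) C k) * l (n ∸ k ∸ 1)) [ n ∸ 1 ])
theorem19 (suc zero)    (s≤s ())
theorem19 (suc (suc m)) _ = begin
  l (suc (suc m))
    ≡⟨ l-suc (suc m) (s≤s z≤n) ⟩
  ∑[ k ∈ [ suc m ] ] (suc m C k) * l (suc m ∸ k)
    ≡⟨ ∑-cong (λ k → cong (λ j → (suc m C k) * l j) (reindex k)) [ suc m ] ⟩
  ∑[ k ∈ [ suc m ] ] (suc m C k) * l (suc (suc m) ∸ k ∸ 1) ∎
  where
  reindex : ∀ k → suc m ∸ k ≡ suc (suc m) ∸ k ∸ 1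
  reindex k = sym (trans (∸-+-assoc (suc (suc m)) k 1) (cong (suc (suc m) ∸_) (+-comm k 1)))
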